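{- Every Halpern--Läuchli ultrafilter on $\omega$ is a $\mathcal Z$-ultrafilter.
   Context: $\mathcal Z=\{A\subseteq\omega:\lim_{n\to\infty}|A\cap n|/n=0\}$. For ideals $\mathcal I,\mathcal J$ on $\omega$, $\mathcal I\le_{\mathrm K}\mathcal J$ means there is $f:\omega\to\omega$ with $f^{ -1}[A]\in\mathcal J$ for all $A\in\mathcal I$. An ultrafilter $\mathcal U$ is a $\mathcal Z$-ultrafilter if $\mathcal Z\not\le_{\mathrm K}\mathcal U^*$, where $\mathcal U^*=\{\omega\setminus U:U\in\mathcal U\}$. A tree is an initial subset of $(2^{<\omega},\subseteq)$ without maximal elements, perfect if every node has two incompatible extensions in it; $\mathbf S$ is the set of perfect trees; $p\restriction A=\{s\in p\cap2^n:n\in A\}$. An ultrafilter $\mathcal U$ is Halpern--Läuchli if for every $c:2^{<\omega}\to2$ there are $p\in\mathbf S$ and $A\in\mathcal U$ with $c$ constant on $p\restriction A$ (equivalently, $\mathcal U$ generates an ultrafilter after adding a Sacks real). -}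

module Defs where

open import Data.Nat using (ℕ; zero; suc; _+_; _*_; _≤_)
open import Data.Bool using (Bool; true; false; not; _∧_)
open import Data.List using (List; []; _∷_; _++_; [_]; length)
open import Data.Product using (Σ; ∃; _×_; _,_)
open import Data.Sum using (_⊎_)
open import Relation.Nullary using (¬_)
open import Relation.Binary.PropositionalEquality using (_≡_)

SubsetΩ : Set
SubsetΩ = ℕ → Bool

_∈ˢ_ : ℕ → SubsetΩ → Set
n ∈ˢ A = A n ≡ true

_⊆ˢ_ : SubsetΩ → SubsetΩ → Set
A ⊆ˢ B = ∀ n → n ∈ˢ A → n ∈ˢ B

_∩ˢ_ : SubsetΩ → SubsetΩ → SubsetΩ
(A ∩ˢ B) n = A n ∧ B n

∁ : SubsetΩ → SubsetΩ
∁ A n = not (A n)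

∅ˢ : SubsetΩ
∅ˢ _ = false

count : SubsetΩ → ℕ → ℕ
count A zero = 0
count A (suc n) with A n
... | true  = suc (count A n)
... | false = count A n

-- The density zero ideal Z: lim |A ∩ n| / n = 0, i.e.
-- for every k, eventually (k+1)·|A ∩ n| ≤ n.
InZ : SubsetΩ → Set
InZ A = ∀ (k : ℕ) → ∃ λ N → ∀ n → N ≤ n → suc k * count A n ≤ n

Family : Set₁
Family = SubsetΩ → Set

record IsUltrafilter (U : Family) : Set where
  field
    upward   : ∀ A B → A ⊆ˢ B → U A → U B
    inter    : ∀ A B → U A → U B → U (A ∩ˢ B)
    proper   : ¬ U ∅ˢ
    ultra    : ∀ A → U A ⊎ U (∁ A)

dual : Family → Family
dual U A = U (∁ A)

preimage : (ℕ → ℕ) → SubsetΩ → SubsetΩ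
preimage f A n = A (f n)

_≤K_ : Family → Family → Set
I ≤K J = ∃ λ (f : ℕ → ℕ) → ∀ A → I A → J (preimage f A)

IsZUltrafilter : Family → Set
IsZUltrafilter U = ¬ (InZ ≤K dual U)

-- Binary sequences 2^{<ω} as lists of booleans; trees as decidable sets of them.
Tree₀ : Set
Tree₀ = List Bool → Bool

_∈ᵗ_ : List Bool → Tree₀ → Set
s ∈ᵗ p = p s ≡ true

_⊑_ : List Bool → List Bool → Set
s ⊑ t = ∃ λ u → s ++ u ≡ t

Incompatible : List Bool → List Bool → Set
Incompatible s t = ¬ (s ⊑ t) × ¬ (t ⊑ s)

record IsTree (p : Tree₀) : Set where
  field
    root      : [] ∈ᵗ p
    initial   : ∀ s t → t ∈ᵗ p → s ⊑ t → s ∈ᵗ p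
    noMaximal : ∀ s → s ∈ᵗ p → ∃ λ (b : Bool) → (s ++ [ b ]) ∈ᵗ p

record IsPerfect (p : Tree₀) : Set where
  field
    tree      : IsTree p
    splitting : ∀ s → s ∈ᵗ p → ∃ λ t → ∃ λ u →
                  (t ∈ᵗ p) × (u ∈ᵗ p) × (s ⊑ t) × (s ⊑ u) × Incompatible t u

ConstantOnRestriction : (List Bool → Bool) → Tree₀ → SubsetΩ → Set
ConstantOnRestriction c p A =
  ∀ s t → s ∈ᵗ p → t ∈ᵗ p → length s ∈ˢ A → length t ∈ˢ A → c s ≡ c t

IsHalpernLauchli : Family → Set
IsHalpernLauchli U = ∀ (c : List Bool → Bool) →
  ∃ λ (p : Tree₀) → Σ SubsetΩ λ A → IsPerfect p × U A × ConstantOnRestriction c p A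

module Submission where

-- Let f witness Z ≤K U*.  Cut ω into blocks [T (k+1), T (k+2)) with T k = 2^2^k and let a
-- number m of block k code the map 2^k → 2 that sends t to the binary digit of m at position
-- fromBits t.  Colour s ∈ 2^n by the value at s ↾ k of the map coded by f n, k being the
-- block of f n.  If the colouring is constant on p ↾ A with p perfect, then for n ∈ A every
-- f n either codes a map that is constant on the level-k nodes of p, or satisfies n < k.
-- Both kinds of numbers form a density zero set Y: a constant pattern on the j nodes of
-- level k has density 2^-j within a block that is long compared with its period 2^2^k, and
-- j grows with k because p is perfect; while below m there are at most (block of m) ≈
-- log log m numbers of the second kind.  Then A ∩ (ω ∖ f⁻¹[Y]) = ∅, although both sets are
-- in U.

open import Defs
open import Data.Nat
open import Data.Nat.Properties
open import Data.Bool using (Bool; true; false; not; _∧_; _∨_; _xor_; if_then_else_; T)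
open import Data.Bool.Properties using (∧-zeroʳ; ∧-identityʳ; ∨-zeroʳ; T-≡)
open import Function.Bundles using (Equivalence)
open import Data.List using (List; []; _∷_; _++_; [_]; length; take; map; foldr)
open import Data.List.Properties using (++-assoc; ++-identityʳ; length-++; length-map; ∷-injective)
open import Data.List.Relation.Unary.All as All using (All; []; _∷_)
import Data.List.Relation.Unary.All.Properties as All
open import Data.List.Relation.Unary.AllPairs using (AllPairs; []; _∷_)
open import Data.List.Relation.Unary.Unique.Propositional using (Unique)
open import Data.Product using (Σ; ∃; _×_; _,_; proj₁; proj₂)
open import Data.Sum using (_⊎_; inj₁; inj₂; [_,_]′)
open import Data.Empty using (⊥-elim)
open import Data.Unit using (tt)
open import Relation.Nullary using (¬_; yes; no; contradiction)
open import Function using (_∘_)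
open import Relation.Binary.PropositionalEquality hiding ([_])
open import Data.Nat.Tactic.RingSolver using (solve-∀)
open import Algebra.Properties.CommutativeSemigroup +-commutativeSemigroup using (x∙yz≈y∙xz)

-- Counting below n

toℕ : Bool → ℕ
toℕ false = 0
toℕ true  = 1

toℕ≤1 : ∀ b → toℕ b ≤ 1
toℕ≤1 false = z≤n
toℕ≤1 true  = s≤s z≤n

count-suc : ∀ A n → count A (suc n) ≡ toℕ (A n) + count A n
count-suc A n with A n
... | true  = refl
... | false = refl

count-cong : ∀ {A B} n → (∀ i → i < n → A i ≡ B i) → count A n ≡ count B n
count-cong zero    A≡B = refl
count-cong {A} {B} (suc n) A≡B = begin
  count A (suc n)         ≡⟨ count-suc A n ⟩
  toℕ (A n) + count A n   ≡⟨ cong₂ _+_ (cong toℕ (A≡B n ≤-refl)) (count-cong n (λ i i<n → A≡B i (m≤n⇒m≤1+n i<n))) ⟩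
  toℕ (B n) + count B n   ≡⟨ count-suc B n ⟨
  count B (suc n)         ∎
  where open ≡-Reasoning

count-+ : ∀ A m n → count A (m + n) ≡ count A m + count (λ i → A (m + i)) n
count-+ A m zero    = trans (cong (count A) (+-identityʳ m)) (sym (+-identityʳ _))
count-+ A m (suc n) = begin
  count A (m + suc n)                                        ≡⟨ cong (count A) (+-suc m n) ⟩
  count A (suc (m + n))                                      ≡⟨ count-suc A (m + n) ⟩
  toℕ (A (m + n)) + count A (m + n)                          ≡⟨ cong (toℕ (A (m + n)) +_) (count-+ A m n) ⟩
  toℕ (A (m + n)) + (count A m + count (λ i → A (m + i)) n)  ≡⟨ x∙yz≈y∙xz (toℕ (A (m + n))) (count A m) _ ⟩
  count A m + (toℕ (A (m + n)) + count (λ i → A (m + i)) n)  ≡⟨ cong (count A m +_) (count-suc (λ i → A (m + i)) n) ⟨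
  count A m + count (λ i → A (m + i)) (suc n)                ∎
  where open ≡-Reasoning

count-head : ∀ A n → count A (suc n) ≡ toℕ (A 0) + count (A ∘ suc) n
count-head A n = trans (count-+ A 1 n) (cong (_+ count (A ∘ suc) n) (trans (count-suc A 0) (+-identityʳ _)))

count-mono : ∀ A {m n} → m ≤ n → count A m ≤ count A n
count-mono A {m} {n} m≤n = begin
  count A m                                          ≤⟨ m≤m+n (count A m) _ ⟩
  count A m + count (λ i → A (m + i)) (n ∸ m)        ≡⟨ count-+ A m (n ∸ m) ⟨
  count A (m + (n ∸ m))                              ≡⟨ cong (count A) (m+[n∸m]≡n m≤n) ⟩
  count A n                                          ∎
  where open ≤-Reasoning

count-∨ : ∀ A B n → count (λ i → A i ∨ B i) n ≤ count A n + count B n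
count-∨ A B zero    = z≤n
count-∨ A B (suc n) with A n | B n
... | true  | true  = s≤s (≤-trans (count-∨ A B n) (+-monoʳ-≤ (count A n) (n≤1+n (count B n))))
... | true  | false = s≤s (count-∨ A B n)
... | false | true  = ≤-trans (s≤s (count-∨ A B n)) (≤-reflexive (sym (+-suc _ _)))
... | false | false = count-∨ A B n

count-double : ∀ A n → count A (n + n) ≡ count (λ i → A (i + i)) n + count (λ i → A (suc (i + i))) n
count-double A zero    = refl
count-double A (suc n) = begin
  count A (suc n + suc n)                                     ≡⟨ cong (count A ∘ suc) (+-suc n n) ⟩
  count A (suc (suc (n + n)))                                 ≡⟨ count-suc A _ ⟩
  toℕ (A (suc (n + n))) + count A (suc (n + n))               ≡⟨ cong (toℕ (A (suc (n + n))) +_) (count-suc A _) ⟩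
  toℕ (A (suc (n + n))) + (toℕ (A (n + n)) + count A (n + n)) ≡⟨ cong (λ c → toℕ (A (suc (n + n))) + (toℕ (A (n + n)) + c)) (count-double A n) ⟩
  toℕ (A (suc (n + n))) + (toℕ (A (n + n)) + (E + O))         ≡⟨ shuffle (toℕ (A (suc (n + n)))) (toℕ (A (n + n))) E O ⟩
  (toℕ (A (n + n)) + E) + (toℕ (A (suc (n + n))) + O)         ≡⟨ cong₂ _+_ (count-suc (λ i → A (i + i)) n) (count-suc (λ i → A (suc (i + i))) n) ⟨
  count (λ i → A (i + i)) (suc n) + count (λ i → A (suc (i + i))) (suc n) ∎
  where
  open ≡-Reasoning
  E = count (λ i → A (i + i)) n
  O = count (λ i → A (suc (i + i))) n
  shuffle : ∀ a b c d → a + (b + (c + d)) ≡ (b + c) + (a + d)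
  shuffle = solve-∀

_─_ : SubsetΩ → ℕ → SubsetΩ
(A ─ v) i = A i ∧ not (i ≡ᵇ v)

─-≢ : ∀ A {i v} → i ≢ v → (A ─ v) i ≡ A i
─-≢ A {i} {v} i≢v with i ≡ᵇ v in i≡ᵇv
... | true  = ⊥-elim (i≢v (≡ᵇ⇒≡ i v (subst T (sym i≡ᵇv) tt)))
... | false = ∧-identityʳ (A i)

─-self : ∀ A v → (A ─ v) v ≡ false
─-self A v with v ≡ᵇ v in v≡ᵇv
... | true  = ∧-zeroʳ (A v)
... | false = ⊥-elim (subst T v≡ᵇv (≡⇒≡ᵇ v v refl))

count-─-≥ : ∀ A {v} n → n ≤ v → count (A ─ v) n ≡ count A n
count-─-≥ A n n≤v = count-cong n (λ i i<n → ─-≢ A (<⇒≢ (<-≤-trans i<n n≤v)))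

count-─ : ∀ A {v} n → v < n → count A n ≡ toℕ (A v) + count (A ─ v) n
count-─ A {v} (suc n) (s≤s v≤n) with m≤n⇒m<n∨m≡n v≤n
... | inj₂ refl = begin
  count A (suc v)                          ≡⟨ count-suc A v ⟩
  toℕ (A v) + count A v                    ≡⟨ cong (toℕ (A v) +_) (count-─-≥ A v ≤-refl) ⟨
  toℕ (A v) + count (A ─ v) v              ≡⟨ cong (λ b → toℕ (A v) + (toℕ b + count (A ─ v) v)) (─-self A v) ⟨
  toℕ (A v) + (toℕ ((A ─ v) v) + count (A ─ v) v) ≡⟨ cong (toℕ (A v) +_) (count-suc (A ─ v) v) ⟨
  toℕ (A v) + count (A ─ v) (suc v)        ∎
  where open ≡-Reasoning
... | inj₁ v<n = begin
  count A (suc n)                                    ≡⟨ count-suc A n ⟩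
  toℕ (A n) + count A n                              ≡⟨ cong (toℕ (A n) +_) (count-─ A n v<n) ⟩
  toℕ (A n) + (toℕ (A v) + count (A ─ v) n)          ≡⟨ x∙yz≈y∙xz (toℕ (A n)) (toℕ (A v)) _ ⟩
  toℕ (A v) + (toℕ (A n) + count (A ─ v) n)          ≡⟨ cong (λ b → toℕ (A v) + (toℕ b + count (A ─ v) n)) (─-≢ A (<⇒≢ v<n ∘ sym)) ⟨
  toℕ (A v) + (toℕ ((A ─ v) n) + count (A ─ v) n)    ≡⟨ cong (toℕ (A v) +_) (count-suc (A ─ v) n) ⟨
  toℕ (A v) + count (A ─ v) (suc n)                  ∎
  where open ≡-Reasoning

count≤1+count-─ : ∀ A v n → count A n ≤ suc (count (A ─ v) n)
count≤1+count-─ A v n with v <? n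
... | yes v<n = ≤-trans (≤-reflexive (count-─ A n v<n)) (+-monoˡ-≤ _ (toℕ≤1 (A v)))
... | no  v≮n = ≤-trans (≤-reflexive (sym (count-─-≥ A n (≮⇒≥ v≮n)))) (n≤1+n _)

count-≡0 : ∀ A n → (∀ i → i < n → ¬ i ∈ˢ A) → count A n ≡ 0
count-≡0 A zero    _     = refl
count-≡0 A (suc n) A∩n=∅ with A n in An
... | true  = ⊥-elim (A∩n=∅ n ≤-refl An)
... | false = count-≡0 A n (λ i i<n → A∩n=∅ i (m≤n⇒m≤1+n i<n))

count-∅ : ∀ n → count ∅ˢ n ≡ 0
count-∅ n = count-≡0 ∅ˢ n (λ _ _ ())

length≤count : ∀ A n (W : List ℕ) → Unique W → All (λ i → i < n × i ∈ˢ A) W → length W ≤ count A n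
length≤count A n []      _             _                 = z≤n
length≤count A n (v ∷ W) (v∉W ∷ uniq) ((v<n , v∈A) ∷ W⊆A) = begin
  suc (length W)           ≤⟨ s≤s (length≤count (A ─ v) n W uniq (kept W v∉W W⊆A)) ⟩
  suc (count (A ─ v) n)    ≡⟨ cong (λ b → toℕ b + count (A ─ v) n) v∈A ⟨
  toℕ (A v) + count (A ─ v) n ≡⟨ count-─ A n v<n ⟨
  count A n                ∎
  where
  open ≤-Reasoning
  kept : ∀ W → All (v ≢_) W → All (λ i → i < n × i ∈ˢ A) W → All (λ i → i < n × i ∈ˢ (A ─ v)) W
  kept []      _              _                = []
  kept (i ∷ W) (v≢i ∷ v∉W) ((i<n , i∈A) ∷ W⊆A) = (i<n , trans (─-≢ A (v≢i ∘ sym)) i∈A) ∷ kept W v∉W W⊆A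

count≤image : ∀ (g : ℕ → ℕ) j A n → (∀ m → m < n → m ∈ˢ A → ∃ λ i → i < j × g i ≡ m) → count A n ≤ j
count≤image g zero    A n A⊆g[0] = ≤-reflexive (count-≡0 A n λ m m<n m∈A → 0≮image (A⊆g[0] m m<n m∈A))
  where
  0≮image : ∀ {m} → ¬ (∃ λ i → i < 0 × g i ≡ m)
  0≮image (_ , () , _)
count≤image g (suc j) A n A⊆g[j+1] =
  ≤-trans (count≤1+count-─ A (g j) n) (s≤s (count≤image g j (A ─ g j) n A─gj⊆g[j]))
  where
  A─gj⊆g[j] : ∀ m → m < n → m ∈ˢ (A ─ g j) → ∃ λ i → i < j × g i ≡ m
  A─gj⊆g[j] m m<n m∈A─gj with m ≟ g j
  ... | yes refl with () ← trans (sym (─-self A m)) m∈A─gj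
  ... | no m≢gj with A⊆g[j+1] m m<n (trans (sym (─-≢ A m≢gj)) m∈A─gj)
  ...   | i , i<j+1 , gi≡m with m≤n⇒m<n∨m≡n (≤-pred i<j+1)
  ...     | inj₁ i<j  = i , i<j , gi≡m
  ...     | inj₂ refl = ⊥-elim (m≢gj (sym gi≡m))

anyBelow : ℕ → (ℕ → Bool) → Bool
anyBelow zero    P = false
anyBelow (suc j) P = P j ∨ anyBelow j P

anyBelow-intro : ∀ j P n → n < j → P n ≡ true → anyBelow j P ≡ true
anyBelow-intro (suc j) P n (s≤s n≤j) Pn with m≤n⇒m<n∨m≡n n≤j
... | inj₂ refl = cong (_∨ anyBelow j P) Pn
... | inj₁ n<j  = trans (cong (P j ∨_) (anyBelow-intro j P n n<j Pn)) (∨-zeroʳ (P j))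

anyBelow-elim : ∀ j P → anyBelow j P ≡ true → ∃ λ n → n < j × P n ≡ true
anyBelow-elim (suc j) P any with P j in Pj
... | true  = j , ≤-refl , Pj
... | false with anyBelow-elim j P any
...   | n , n<j , Pn = n , m≤n⇒m≤1+n n<j , Pn

InZ-∪ : ∀ {A B} → InZ A → InZ B → InZ (λ n → A n ∨ B n)
InZ-∪ {A} {B} A∈Z B∈Z k with A∈Z (k + suc k) | B∈Z (k + suc k)
... | M , A-sparse | N , B-sparse = M ⊔ N , λ n M⊔N≤n → *-cancelˡ-≤ 2 (begin
  2 * (suc k * count (λ i → A i ∨ B i) n)               ≤⟨ *-monoʳ-≤ 2 (*-monoʳ-≤ (suc k) (count-∨ A B n)) ⟩
  2 * (suc k * (count A n + count B n))                 ≡⟨ double-distrib k (count A n) (count B n) ⟩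
  suc (k + suc k) * count A n + suc (k + suc k) * count B n
    ≤⟨ +-mono-≤ (A-sparse n (m⊔n≤o⇒m≤o M N M⊔N≤n)) (B-sparse n (m⊔n≤o⇒n≤o M N M⊔N≤n)) ⟩
  n + n                                                 ≡⟨ cong (n +_) (+-identityʳ n) ⟨
  2 * n                                                 ∎)
  where
  open ≤-Reasoning
  double-distrib : ∀ k a b → 2 * (suc k * (a + b)) ≡ suc (k + suc k) * a + suc (k + suc k) * b
  double-distrib = solve-∀

count-periodic-≤ : ∀ A P c .{{_ : NonZero P}} → (∀ i → A (P + i) ≡ A i) → count A P * c ≡ P →
                   ∀ d → count A d * c ≤ d + P
count-periodic-≤ A P c periodic period-count d = below-multiple d d (m≤m*n d P)
  where
  open ≤-Reasoning
  below-multiple : ∀ q d → d ≤ q * P → count A d * c ≤ d + P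
  below-multiple zero    zero    _   = z≤n
  below-multiple (suc q) d       d≤P+qP with d ≤? P
  ... | yes d≤P = begin
    count A d * c  ≤⟨ *-monoˡ-≤ c (count-mono A d≤P) ⟩
    count A P * c  ≡⟨ period-count ⟩
    P              ≤⟨ m≤n+m P d ⟩
    d + P          ∎
  ... | no  d≰P = begin
    count A d * c                                   ≡⟨ cong (λ x → count A x * c) P+e≡d ⟨
    count A (P + e) * c                             ≡⟨ cong (_* c) (count-+ A P e) ⟩
    (count A P + count (λ i → A (P + i)) e) * c     ≡⟨ cong (λ x → (count A P + x) * c) (count-cong e (λ i _ → periodic i)) ⟩
    (count A P + count A e) * c                     ≡⟨ *-distribʳ-+ c (count A P) (count A e) ⟩
    count A P * c + count A e * c                   ≡⟨ cong (_+ count A e * c) period-count ⟩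
    P + count A e * c                               ≤⟨ +-monoʳ-≤ P (below-multiple q e (≤-trans (∸-monoˡ-≤ P d≤P+qP) (≤-reflexive (m+n∸m≡n P (q * P))))) ⟩
    P + (e + P)                                     ≡⟨ +-assoc P e P ⟨
    (P + e) + P                                     ≡⟨ cong (_+ P) P+e≡d ⟩
    d + P                                           ∎
    where
    e = d ∸ P
    P+e≡d : P + e ≡ d
    P+e≡d = m+[n∸m]≡n (<⇒≤ (≰⇒> d≰P))

-- Binary digits

odd : ℕ → Bool
odd zero          = false
odd (suc zero)    = true
odd (suc (suc n)) = odd n

bit : ℕ → ℕ → Bool
bit zero    m = odd m
bit (suc i) m = bit i ⌊ m /2⌋

odd-+-double : ∀ z y → odd (z + z + y) ≡ odd y
odd-+-double zero    y = refl
odd-+-double (suc z) y rewrite +-suc z z = odd-+-double z y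

⌊+-double/2⌋ : ∀ z y → ⌊ z + z + y /2⌋ ≡ z + ⌊ y /2⌋
⌊+-double/2⌋ zero    y = refl
⌊+-double/2⌋ (suc z) y rewrite +-suc z z = cong suc (⌊+-double/2⌋ z y)

odd-digit : ∀ b v → odd (toℕ b + (v + v)) ≡ b
odd-digit false v = trans (cong odd (sym (+-identityʳ (v + v)))) (odd-+-double v 0)
odd-digit true  v = trans (cong odd (+-comm 1 (v + v))) (odd-+-double v 1)

⌊digit/2⌋ : ∀ b v → ⌊ toℕ b + (v + v) /2⌋ ≡ v
⌊digit/2⌋ false v = trans (cong ⌊_/2⌋ (sym (+-identityʳ (v + v)))) (trans (⌊+-double/2⌋ v 0) (+-identityʳ v))
⌊digit/2⌋ true  v = trans (cong ⌊_/2⌋ (+-comm 1 (v + v))) (trans (⌊+-double/2⌋ v 1) (+-identityʳ v))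

odd+⌊/2⌋ : ∀ i → toℕ (odd i) + (⌊ i /2⌋ + ⌊ i /2⌋) ≡ i
odd+⌊/2⌋ zero          = refl
odd+⌊/2⌋ (suc zero)    = refl
odd+⌊/2⌋ (suc (suc i)) = begin
  toℕ (odd i) + (suc ⌊ i /2⌋ + suc ⌊ i /2⌋)   ≡⟨ cong (toℕ (odd i) +_) (cong suc (+-suc ⌊ i /2⌋ ⌊ i /2⌋)) ⟩
  toℕ (odd i) + suc (suc (⌊ i /2⌋ + ⌊ i /2⌋)) ≡⟨ +-suc (toℕ (odd i)) _ ⟩
  suc (toℕ (odd i) + suc (⌊ i /2⌋ + ⌊ i /2⌋)) ≡⟨ cong suc (+-suc (toℕ (odd i)) _) ⟩
  suc (suc (toℕ (odd i) + (⌊ i /2⌋ + ⌊ i /2⌋))) ≡⟨ cong (suc ∘ suc) (odd+⌊/2⌋ i) ⟩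
  suc (suc i)                                 ∎
  where open ≡-Reasoning

2^suc : ∀ k → 2 ^ suc k ≡ 2 ^ k + 2 ^ k
2^suc k = cong (2 ^ k +_) (+-identityʳ (2 ^ k))

n<2^n : ∀ n → n < 2 ^ n
n<2^n zero    = s≤s z≤n
n<2^n (suc n) = begin-strict
  suc n          <⟨ s≤s (n<2^n n) ⟩
  suc (2 ^ n)    ≤⟨ +-monoˡ-≤ (2 ^ n) (m^n>0 2 n) ⟩
  2 ^ n + 2 ^ n  ≡⟨ 2^suc n ⟨
  2 ^ suc n      ∎
  where open ≤-Reasoning

⌊/2⌋-< : ∀ i k → i < 2 ^ suc k → ⌊ i /2⌋ < 2 ^ k
⌊/2⌋-< i k i<2^[1+k] with ⌊ i /2⌋ <? 2 ^ k
... | yes h = h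
... | no  h = contradiction i<2^[1+k] (≤⇒≯ (begin
  2 ^ suc k                         ≡⟨ 2^suc k ⟩
  2 ^ k + 2 ^ k                     ≤⟨ +-mono-≤ (≮⇒≥ h) (≮⇒≥ h) ⟩
  ⌊ i /2⌋ + ⌊ i /2⌋                 ≤⟨ m≤n+m _ (toℕ (odd i)) ⟩
  toℕ (odd i) + (⌊ i /2⌋ + ⌊ i /2⌋) ≡⟨ odd+⌊/2⌋ i ⟩
  i                                 ∎))
  where open ≤-Reasoning

fromBits : List Bool → ℕ
fromBits []      = 0
fromBits (b ∷ t) = toℕ b + (fromBits t + fromBits t)

toBits : ℕ → ℕ → List Bool
toBits zero    i = []
toBits (suc k) i = odd i ∷ toBits k ⌊ i /2⌋

length-toBits : ∀ k i → length (toBits k i) ≡ k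
length-toBits zero    i = refl
length-toBits (suc k) i = cong suc (length-toBits k ⌊ i /2⌋)

toBits-fromBits : ∀ t → toBits (length t) (fromBits t) ≡ t
toBits-fromBits []      = refl
toBits-fromBits (b ∷ t) = cong₂ _∷_ (odd-digit b (fromBits t))
  (trans (cong (toBits (length t)) (⌊digit/2⌋ b (fromBits t))) (toBits-fromBits t))

fromBits-toBits : ∀ k i → i < 2 ^ k → fromBits (toBits k i) ≡ i
fromBits-toBits zero    zero    _         = refl
fromBits-toBits zero    (suc i) (s≤s ())
fromBits-toBits (suc k) i       i<2^[1+k] =
  trans (cong (λ v → toℕ (odd i) + (v + v)) (fromBits-toBits k ⌊ i /2⌋ (⌊/2⌋-< i k i<2^[1+k]))) (odd+⌊/2⌋ i)

fromBits-< : ∀ t → fromBits t < 2 ^ length t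
fromBits-< []      = s≤s z≤n
fromBits-< (b ∷ t) = begin-strict
  toℕ b + (fromBits t + fromBits t)    <⟨ s≤s (+-monoˡ-≤ _ (toℕ≤1 b)) ⟩
  suc (suc (fromBits t + fromBits t))  ≡⟨ cong suc (+-suc (fromBits t) (fromBits t)) ⟨
  suc (fromBits t) + suc (fromBits t)  ≤⟨ +-mono-≤ (fromBits-< t) (fromBits-< t) ⟩
  2 ^ length t + 2 ^ length t          ≡⟨ 2^suc (length t) ⟨
  2 ^ suc (length t)                   ∎
  where open ≤-Reasoning

-- Digit patterns

_==_ : Bool → Bool → Bool
b == x = not (b xor x)

==-refl : ∀ b → (b == b) ≡ true
==-refl false = refl
==-refl true  = refl

Agrees : ℕ → (ℕ → Bool) → Bool → ℕ → Bool
Agrees zero    S b m = true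
Agrees (suc M) S b m = (not (S 0) ∨ (b == odd m)) ∧ Agrees M (S ∘ suc) b ⌊ m /2⌋

Agrees-digit : ∀ M S b x v → Agrees (suc M) S b (toℕ x + (v + v)) ≡ (not (S 0) ∨ (b == x)) ∧ Agrees M (S ∘ suc) b v
Agrees-digit M S b x v = cong₂ (λ y w → (not (S 0) ∨ (b == y)) ∧ Agrees M (S ∘ suc) b w) (odd-digit x v) (⌊digit/2⌋ x v)

Agrees-count : ∀ M S b → count (Agrees M S b) (2 ^ M) * 2 ^ count S M ≡ 2 ^ M
Agrees-count zero    S b = refl
Agrees-count (suc M) S b = begin
  count (Agrees (suc M) S b) (2 ^ suc M) * 2 ^ count S (suc M)
    ≡⟨ cong₂ (λ n c → count (Agrees (suc M) S b) n * 2 ^ c) (2^suc M) (count-head S M) ⟩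
  count (Agrees (suc M) S b) (P + P) * 2 ^ (toℕ (S 0) + c)
    ≡⟨ cong (_* 2 ^ (toℕ (S 0) + c)) (count-double (Agrees (suc M) S b) P) ⟩
  (count (λ i → Agrees (suc M) S b (i + i)) P + count (λ i → Agrees (suc M) S b (suc (i + i))) P) * 2 ^ (toℕ (S 0) + c)
    ≡⟨ cong (_* 2 ^ (toℕ (S 0) + c)) (cong₂ _+_ (count-cong P (λ i _ → Agrees-digit M S b false i))
                                                 (count-cong P (λ i _ → Agrees-digit M S b true i))) ⟩
  (count (λ i → (not (S 0) ∨ (b == false)) ∧ X i) P + count (λ i → (not (S 0) ∨ (b == true)) ∧ X i) P) * 2 ^ (toℕ (S 0) + c)
    ≡⟨ halves (S 0) b ⟩
  count X P * 2 ^ c + count X P * 2 ^ c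
    ≡⟨ cong₂ _+_ (Agrees-count M (S ∘ suc) b) (Agrees-count M (S ∘ suc) b) ⟩
  P + P
    ≡⟨ 2^suc M ⟨
  2 ^ suc M ∎
  where
  open ≡-Reasoning
  P = 2 ^ M
  X = Agrees M (S ∘ suc) b
  c = count (S ∘ suc) M
  F*2c≡F*c+F*c : ∀ F c → F * (2 * c) ≡ F * c + F * c
  F*2c≡F*c+F*c = solve-∀
  halves : ∀ s b → (count (λ i → (not s ∨ (b == false)) ∧ X i) P + count (λ i → (not s ∨ (b == true)) ∧ X i) P)
                   * 2 ^ (toℕ s + c) ≡ count X P * 2 ^ c + count X P * 2 ^ c
  halves false _     = *-distribʳ-+ (2 ^ c) (count X P) (count X P)
  halves true  false = begin
    (count X P + count ∅ˢ P) * 2 ^ suc c  ≡⟨ cong (λ z → (count X P + z) * 2 ^ suc c) (count-∅ P) ⟩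
    (count X P + 0) * 2 ^ suc c          ≡⟨ cong (_* 2 ^ suc c) (+-identityʳ (count X P)) ⟩
    count X P * 2 ^ suc c                ≡⟨ F*2c≡F*c+F*c (count X P) (2 ^ c) ⟩
    count X P * 2 ^ c + count X P * 2 ^ c ∎
  halves true  true  = begin
    (count ∅ˢ P + count X P) * 2 ^ suc c  ≡⟨ cong (λ z → (z + count X P) * 2 ^ suc c) (count-∅ P) ⟩
    count X P * 2 ^ suc c                ≡⟨ F*2c≡F*c+F*c (count X P) (2 ^ c) ⟩
    count X P * 2 ^ c + count X P * 2 ^ c ∎

Agrees-periodic : ∀ M S b q y → Agrees M S b (2 ^ M * q + y) ≡ Agrees M S b y
Agrees-periodic zero    S b q y = refl
Agrees-periodic (suc M) S b q y = begin
  Agrees (suc M) S b (2 * 2 ^ M * q + y)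
    ≡⟨ cong (λ n → Agrees (suc M) S b (n + y)) (double-* (2 ^ M) q) ⟩
  Agrees (suc M) S b (z + z + y)
    ≡⟨ cong₂ (λ o h → (not (S 0) ∨ (b == o)) ∧ Agrees M (S ∘ suc) b h) (odd-+-double z y) (⌊+-double/2⌋ z y) ⟩
  (not (S 0) ∨ (b == odd y)) ∧ Agrees M (S ∘ suc) b (2 ^ M * q + ⌊ y /2⌋)
    ≡⟨ cong ((not (S 0) ∨ (b == odd y)) ∧_) (Agrees-periodic M (S ∘ suc) b q ⌊ y /2⌋) ⟩
  Agrees (suc M) S b y ∎
  where
  open ≡-Reasoning
  z = 2 ^ M * q
  double-* : ∀ a q → 2 * a * q ≡ a * q + a * q
  double-* = solve-∀

Agrees-density : ∀ M S b d → count (Agrees M S b) d * 2 ^ count S M ≤ d + 2 ^ M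
Agrees-density M S b = count-periodic-≤ (Agrees M S b) (2 ^ M) (2 ^ count S M) {{m^n≢0 2 M}}
  (λ i → trans (cong (λ P → Agrees M S b (P + i)) (sym (*-identityʳ (2 ^ M)))) (Agrees-periodic M S b 1 i))
  (Agrees-count M S b)

Agrees-intro : ∀ M S b m → (∀ i → i < M → S i ≡ true → bit i m ≡ b) → Agrees M S b m ≡ true
Agrees-intro zero    S b m _ = refl
Agrees-intro (suc M) S b m bits≡b = cong₂ _∧_ first-digit (Agrees-intro M (S ∘ suc) b ⌊ m /2⌋ (λ i i<M → bits≡b (suc i) (s≤s i<M)))
  where
  first-digit : (not (S 0) ∨ (b == odd m)) ≡ true
  first-digit with S 0 in S0
  ... | false = refl
  ... | true  = trans (cong (b ==_) (bits≡b 0 z<s S0)) (==-refl b)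

-- Trees

⊑-refl : ∀ s → s ⊑ s
⊑-refl s = [] , ++-identityʳ s

⊑-trans : ∀ {s t w} → s ⊑ t → t ⊑ w → s ⊑ w
⊑-trans {s} (u , refl) (v , refl) = u ++ v , sym (++-assoc s u v)

⊑-comparable : ∀ s t {w} → s ⊑ w → t ⊑ w → s ⊑ t ⊎ t ⊑ s
⊑-comparable []      t       _       _       = inj₁ (t , refl)
⊑-comparable (a ∷ s) []      _       _       = inj₂ (a ∷ s , refl)
⊑-comparable (a ∷ s) (b ∷ t) (u , refl) (v , bt++v≡as++u) with ∷-injective bt++v≡as++u
... | refl , t++v≡s++u with ⊑-comparable s t (u , refl) (v , t++v≡s++u)
...   | inj₁ (x , s++x≡t) = inj₁ (x , cong (a ∷_) s++x≡t)
...   | inj₂ (x , t++x≡s) = inj₂ (x , cong (a ∷_) t++x≡s)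

Incompatible-⊑ : ∀ {s t o} → s ⊑ t → Incompatible s o → Incompatible t o
Incompatible-⊑ {s} {t} {o} s⊑t (s⋢o , o⋢s) =
  (λ t⊑o → s⋢o (⊑-trans s⊑t t⊑o)) , (λ o⊑t → [ s⋢o , o⋢s ]′ (⊑-comparable s o s⊑t o⊑t))

take-⊑ : ∀ {t s} → t ⊑ s → take (length t) s ≡ t
take-⊑ {[]}    _          = refl
take-⊑ {b ∷ t} (u , refl) = cong (b ∷_) (take-⊑ (u , refl))

module TreeExtensions {p : Tree₀} (tree : IsTree p) where
  open IsTree tree

  child : List Bool → List Bool
  child s = if p (s ++ [ false ]) then s ++ [ false ] else s ++ [ true ]

  child-∈ : ∀ s → s ∈ᵗ p → child s ∈ᵗ p
  child-∈ s s∈p with p (s ++ [ false ]) in s0∈p | noMaximal s s∈p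
  ... | true  | _          = s0∈p
  ... | false | true  , h  = h
  ... | false | false , h  with () ← trans (sym s0∈p) h

  ⊑-child : ∀ s → ∃ λ b → child s ≡ s ++ [ b ]
  ⊑-child s with p (s ++ [ false ])
  ... | true  = false , refl
  ... | false = true , refl

  extendBy : ℕ → List Bool → List Bool
  extendBy zero    s = s
  extendBy (suc j) s = extendBy j (child s)

  extendBy-∈ : ∀ j s → s ∈ᵗ p → extendBy j s ∈ᵗ p
  extendBy-∈ zero    s s∈p = s∈p
  extendBy-∈ (suc j) s s∈p = extendBy-∈ j (child s) (child-∈ s s∈p)

  length-extendBy : ∀ j s → length (extendBy j s) ≡ length s + j
  length-extendBy zero    s = sym (+-identityʳ _)
  length-extendBy (suc j) s with ⊑-child s
  ... | b , child≡s++b = begin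
    length (extendBy j (child s))   ≡⟨ length-extendBy j (child s) ⟩
    length (child s) + j            ≡⟨ cong (λ c → length c + j) child≡s++b ⟩
    length (s ++ [ b ]) + j         ≡⟨ cong (_+ j) (length-++ s) ⟩
    length s + 1 + j                ≡⟨ +-assoc (length s) 1 j ⟩
    length s + suc j                ∎
    where open ≡-Reasoning

  ⊑-extendBy : ∀ j s → s ⊑ extendBy j s
  ⊑-extendBy zero    s = ⊑-refl s
  ⊑-extendBy (suc j) s with ⊑-child s
  ... | b , child≡s++b = ⊑-trans ([ b ] , sym child≡s++b) (⊑-extendBy j (child s))

  extendTo : ℕ → List Bool → List Bool
  extendTo k s = extendBy (k ∸ length s) s

  extendTo-∈ : ∀ k s → s ∈ᵗ p → extendTo k s ∈ᵗ p
  extendTo-∈ k s = extendBy-∈ (k ∸ length s) s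

  length-extendTo : ∀ k s → length s ≤ k → length (extendTo k s) ≡ k
  length-extendTo k s s≤k = trans (length-extendBy (k ∸ length s) s) (m+[n∸m]≡n s≤k)

  ⊑-extendTo : ∀ k s → s ⊑ extendTo k s
  ⊑-extendTo k s = ⊑-extendBy (k ∸ length s) s

height : List (List Bool) → ℕ
height = foldr (λ s h → length s ⊔ h) 0

All-≤-height : ∀ V → All (λ s → length s ≤ height V) V
All-≤-height []      = []
All-≤-height (s ∷ V) = m≤m⊔n (length s) (height V) ∷ All.map (λ s≤h → ≤-trans s≤h (m≤n⊔m (length s) (height V))) (All-≤-height V)

module LevelSizes {p : Tree₀} (perfect : IsPerfect p) where
  open IsPerfect perfect
  open IsTree tree
  open TreeExtensions tree

  nodesAt : ℕ → SubsetΩ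
  nodesAt k i = p (toBits k i)

  antichain : ∀ r → Σ (List (List Bool)) λ V → length V ≡ suc r × All (_∈ᵗ p) V × AllPairs Incompatible V
  antichain zero = [] ∷ [] , refl , root ∷ [] , [] ∷ []
  antichain (suc r) with antichain r
  ... | [] , () , _
  ... | s ∷ V , |V|≡r , s∈p ∷ V⊆p , s#V ∷ V-antichain with splitting s s∈p
  ...   | t , u , t∈p , u∈p , s⊑t , s⊑u , t#u =
    t ∷ u ∷ V , cong suc |V|≡r , t∈p ∷ u∈p ∷ V⊆p ,
    (t#u ∷ All.map (Incompatible-⊑ s⊑t) s#V) ∷ All.map (Incompatible-⊑ s⊑u) s#V ∷ V-antichain

  position : ℕ → List Bool → ℕ
  position k t = fromBits (extendTo k t)

  position-∈ : ∀ {k t} → t ∈ᵗ p → length t ≤ k → position k t < 2 ^ k × position k t ∈ˢ nodesAt k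
  position-∈ {k} {t} t∈p t≤k =
    subst (λ n → position k t < 2 ^ n) |e|≡k (fromBits-< e) ,
    trans (cong p (subst (λ n → toBits n (fromBits e) ≡ e) |e|≡k (toBits-fromBits e))) (extendTo-∈ k t t∈p)
    where
    e = extendTo k t
    |e|≡k = length-extendTo k t t≤k

  position-injective : ∀ {k t o} → length t ≤ k → length o ≤ k → Incompatible t o → position k t ≢ position k o
  position-injective {k} {t} {o} t≤k o≤k (t⋢o , o⋢t) same-position =
    [ t⋢o , o⋢t ]′ (⊑-comparable t o (⊑-extendTo k t) (subst (o ⊑_) (sym same-extension) (⊑-extendTo k o)))
    where
    decode : ∀ s → length s ≤ k → toBits k (position k s) ≡ extendTo k s
    decode s s≤k = subst (λ n → toBits n (position k s) ≡ extendTo k s) (length-extendTo k s s≤k) (toBits-fromBits (extendTo k s))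
    same-extension : extendTo k t ≡ extendTo k o
    same-extension = trans (sym (decode t t≤k)) (trans (cong (toBits k) same-position) (decode o o≤k))

  positions-unique : ∀ {k} V → All (λ t → length t ≤ k) V → AllPairs Incompatible V → Unique (map (position k) V)
  positions-unique []      []            []                  = []
  positions-unique (t ∷ V) (t≤k ∷ V≤k) (t#V ∷ V-antichain) =
    All.map⁺ (All.zipWith (λ (o≤k , t#o) → position-injective t≤k o≤k t#o) (V≤k , t#V)) ∷ positions-unique V V≤k V-antichain

  level-size-unbounded : ∀ r → ∃ λ L → ∀ k → L ≤ k → suc r ≤ count (nodesAt k) (2 ^ k)
  level-size-unbounded r with antichain r
  ... | V , |V|≡1+r , V⊆p , V-antichain = height V , λ k h≤k →
    let V≤k = All.map (λ t≤h → ≤-trans t≤h h≤k) (All-≤-height V) in begin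
    suc r                         ≡⟨ trans (sym |V|≡1+r) (sym (length-map (position k) V)) ⟩
    length (map (position k) V)   ≤⟨ length≤count (nodesAt k) (2 ^ k) (map (position k) V) (positions-unique V V≤k V-antichain)
                                       (All.map⁺ (All.zipWith (λ (t∈p , t≤k) → position-∈ t∈p t≤k) (V⊆p , V≤k))) ⟩
    count (nodesAt k) (2 ^ k)     ∎
    where open ≤-Reasoning

-- Blocks between towers of twos

tower : ℕ → ℕ
tower k = 2 ^ 2 ^ k

tower-suc : ∀ k → tower (suc k) ≡ tower k * tower k
tower-suc k = trans (cong (2 ^_) (2^suc k)) (^-distribˡ-+-* 2 (2 ^ k) (2 ^ k))

k<tower : ∀ k → k < tower k
k<tower k = <-trans (n<2^n k) (n<2^n (2 ^ k))

tower-mono-≤ : ∀ {a b} → a ≤ b → tower a ≤ tower b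
tower-mono-≤ a≤b = ^-monoʳ-≤ 2 (^-monoʳ-≤ 2 a≤b)

tower-mono-< : ∀ {a b} → a < b → tower a < tower b
tower-mono-< a<b = ^-monoʳ-< 2 (s≤s (s≤s z≤n)) (^-monoʳ-< 2 (s≤s (s≤s z≤n)) a<b)

tower-cancel-< : ∀ {a b} → tower a < tower b → a < b
tower-cancel-< {a} {b} ta<tb with a <? b
... | yes a<b = a<b
... | no  a≮b = contradiction ta<tb (≤⇒≯ (tower-mono-≤ (≮⇒≥ a≮b)))

2*tower≤tower-suc : ∀ k → 2 * tower k ≤ tower (suc k)
2*tower≤tower-suc k = begin
  2 * tower k         ≤⟨ *-monoˡ-≤ (tower k) (tower-mono-≤ {0} {k} z≤n) ⟩
  tower k * tower k   ≡⟨ tower-suc k ⟨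
  tower (suc k)       ∎
  where open ≤-Reasoning

InBlock : ℕ → ℕ → Set
InBlock k m = tower (suc k) ≤ m × m < tower (suc (suc k))

blockOf : ℕ → ℕ
blockOf zero = 0
blockOf (suc m) with tower (suc (suc (blockOf m))) ≤? suc m
... | yes _ = suc (blockOf m)
... | no  _ = blockOf m

blockOf-spec : ∀ m → (m < 4 × blockOf m ≡ 0) ⊎ InBlock (blockOf m) m
blockOf-spec zero = inj₁ (z<s , refl)
blockOf-spec (suc m) with tower (suc (suc (blockOf m))) ≤? suc m | blockOf-spec m
... | yes next≤1+m | inj₂ (_ , m<next)       = inj₂ (next≤1+m , ≤-<-trans m<next (tower-mono-< {suc (suc (blockOf m))} ≤-refl))
... | no  next≰1+m | inj₂ (start≤m , _)      = inj₂ (m≤n⇒m≤1+n start≤m , ≰⇒> next≰1+m)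
... | yes next≤1+m | inj₁ (m<4 , _)          =
  contradiction (≤-trans (tower-mono-≤ {2} {suc (suc (blockOf m))} (s≤s (s≤s z≤n))) next≤1+m) (<⇒≱ (<-≤-trans (s≤s m<4) (m≤m+n 5 11)))
... | no  next≰1+m | inj₁ (m<4 , blockOf≡0) with suc m <? 4
...   | yes 1+m<4 = inj₁ (1+m<4 , blockOf≡0)
...   | no  1+m≮4 rewrite blockOf≡0 = inj₂ (≮⇒≥ 1+m≮4 , ≰⇒> next≰1+m)

InBlock-unique : ∀ {k k′ m} → InBlock k m → InBlock k′ m → k ≡ k′
InBlock-unique (k-start≤m , m<k-end) (k′-start≤m , m<k′-end) = ≤-antisym
  (≤-pred (≤-pred (tower-cancel-< (≤-<-trans k-start≤m m<k′-end))))
  (≤-pred (≤-pred (tower-cancel-< (≤-<-trans k′-start≤m m<k-end))))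

blockOf-InBlock : ∀ m → 4 ≤ m → InBlock (blockOf m) m
blockOf-InBlock m 4≤m with blockOf-spec m
... | inj₁ (m<4 , _) = contradiction 4≤m (<⇒≱ m<4)
... | inj₂ inBlock   = inBlock

InBlock⇒blockOf : ∀ {k m} → InBlock k m → blockOf m ≡ k
InBlock⇒blockOf {k} {m} inBlock@(start≤m , _) =
  InBlock-unique (blockOf-InBlock m (≤-trans (tower-mono-≤ {1} {suc k} (s≤s z≤n)) start≤m)) inBlock

blockOf-mono : ∀ {m n} → m ≤ n → blockOf m ≤ blockOf n
blockOf-mono {m} {zero}  z≤n = ≤-refl
blockOf-mono {m} {suc n} m≤1+n with m≤n⇒m<n∨m≡n m≤1+n
... | inj₂ refl     = ≤-refl
... | inj₁ (s≤s m≤n) = ≤-trans (blockOf-mono m≤n) (blockOf-step n)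
  where
  blockOf-step : ∀ n → blockOf n ≤ blockOf (suc n)
  blockOf-step n with tower (suc (suc (blockOf n))) ≤? suc n
  ... | yes _ = n≤1+n _
  ... | no  _ = ≤-refl

-- Density zero criteria

InZ-of-count≤blockOf : ∀ A → (∀ x → count A x ≤ blockOf x) → InZ A
InZ-of-count≤blockOf A sparse k = 4 ⊔ s * s , λ x N≤x → ≤-trans (*-monoʳ-≤ s (sparse x)) (s*blockOf≤ x N≤x)
  where
  s = suc k
  s*blockOf≤ : ∀ x → 4 ⊔ s * s ≤ x → s * blockOf x ≤ x
  s*blockOf≤ x N≤x with blockOf-InBlock x (m⊔n≤o⇒m≤o 4 (s * s) N≤x) | s ≤? tower (blockOf x)
  ... | start≤x , _ | yes s≤T = begin
    s * blockOf x                        ≤⟨ *-mono-≤ s≤T (<⇒≤ (k<tower (blockOf x))) ⟩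
    tower (blockOf x) * tower (blockOf x) ≡⟨ tower-suc (blockOf x) ⟨
    tower (suc (blockOf x))              ≤⟨ start≤x ⟩
    x                                    ∎
    where open ≤-Reasoning
  ... | _ | no s≰T = begin
    s * blockOf x  ≤⟨ *-monoʳ-≤ s (<⇒≤ (<-trans (k<tower (blockOf x)) (≰⇒> s≰T))) ⟩
    s * s          ≤⟨ m⊔n≤o⇒n≤o 4 (s * s) N≤x ⟩
    x              ∎
    where open ≤-Reasoning

SparseBlocks : SubsetΩ → ℕ → ℕ → Set
SparseBlocks A Q L = ∀ k → L ≤ k → ∀ d → tower (suc k) + d ≤ tower (suc (suc k)) →
  count (λ i → A (tower (suc k) + i)) d * Q ≤ d + tower k

module BlockwiseCount {A Q L} (sparse : SparseBlocks A Q L) where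

  across-block : ∀ k → L ≤ k → ∀ y → tower (suc k) ≤ y → y ≤ tower (suc (suc k)) →
                 count A y * Q ≤ count A (tower (suc k)) * Q + (y ∸ tower (suc k) + tower k)
  across-block k L≤k y start≤y y≤end = begin
    count A y * Q                                                ≡⟨ cong (λ n → count A n * Q) a+d≡y ⟨
    count A (a + d) * Q                                          ≡⟨ cong (_* Q) (count-+ A a d) ⟩
    (count A a + count (λ i → A (a + i)) d) * Q                  ≡⟨ *-distribʳ-+ Q (count A a) _ ⟩
    count A a * Q + count (λ i → A (a + i)) d * Q                ≤⟨ +-monoʳ-≤ _ (sparse k L≤k d (≤-trans (≤-reflexive a+d≡y) y≤end)) ⟩
    count A a * Q + (d + tower k)                                ∎
    where
    open ≤-Reasoning
    a = tower (suc k)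
    d = y ∸ a
    a+d≡y : a + d ≡ y
    a+d≡y = m+[n∸m]≡n start≤y

  C = count A (tower (suc L))

  up-to-block : ∀ j {K} → j + L ≡ K → ∀ y → tower (suc K) ≤ y → y ≤ tower (suc (suc K)) →
                count A y * Q ≤ C * Q + y + 2 * tower K
  up-to-block zero    refl y start≤y y≤end = begin
    count A y * Q                             ≤⟨ across-block L ≤-refl y start≤y y≤end ⟩
    C * Q + (y ∸ tower (suc L) + tower L)     ≤⟨ +-monoʳ-≤ (C * Q) (+-mono-≤ (m∸n≤m y (tower (suc L))) (m≤m+n (tower L) (tower L + 0))) ⟩
    C * Q + (y + 2 * tower L)                 ≡⟨ +-assoc (C * Q) y _ ⟨
    C * Q + y + 2 * tower L                   ∎
    where open ≤-Reasoning
  up-to-block (suc j) {suc K} refl y start≤y y≤end = begin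
    count A y * Q                             ≤⟨ across-block (suc K) (≤-trans (m≤n+m L j) (n≤1+n _)) y start≤y y≤end ⟩
    count A a * Q + (d + tower (suc K))       ≤⟨ +-monoˡ-≤ _ (up-to-block j refl a (<⇒≤ (tower-mono-< {suc K} ≤-refl)) ≤-refl) ⟩
    C * Q + a + 2 * tower K + (d + tower (suc K)) ≡⟨ regroup (C * Q) a (tower K) d (tower (suc K)) ⟩
    C * Q + (a + d) + (2 * tower K + tower (suc K)) ≤⟨ +-mono-≤ (≤-reflexive (cong (C * Q +_) (m+[n∸m]≡n start≤y)))
                                                                 (+-monoˡ-≤ (tower (suc K)) (2*tower≤tower-suc K)) ⟩
    C * Q + y + (tower (suc K) + tower (suc K)) ≡⟨ cong (λ t → C * Q + y + (tower (suc K) + t)) (+-identityʳ _) ⟨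
    C * Q + y + 2 * tower (suc K)             ∎
    where
    open ≤-Reasoning
    a = tower (suc (suc K))
    d = y ∸ a
    regroup : ∀ c a t d u → c + a + 2 * t + (d + u) ≡ c + (a + d) + (2 * t + u)
    regroup = solve-∀

  count-≤-blocks : ∀ x → tower (suc L) ≤ x → count A x * Q ≤ C * Q + 2 * x
  count-≤-blocks x start≤x = begin
    count A x * Q                 ≤⟨ up-to-block (K ∸ L) (m∸n+n≡m L≤K) x K-start≤x (<⇒≤ x<K-end) ⟩
    C * Q + x + 2 * tower K       ≤⟨ +-monoʳ-≤ (C * Q + x) (≤-trans (2*tower≤tower-suc K) K-start≤x) ⟩
    C * Q + x + x                 ≡⟨ +-assoc (C * Q) x x ⟩
    C * Q + (x + x)               ≡⟨ cong (λ t → C * Q + (x + t)) (+-identityʳ x) ⟨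
    C * Q + 2 * x                 ∎
    where
    open ≤-Reasoning
    K = blockOf x
    inBlock = blockOf-InBlock x (≤-trans (tower-mono-≤ {1} {suc L} (s≤s z≤n)) start≤x)
    K-start≤x = proj₁ inBlock
    x<K-end = proj₂ inBlock
    L≤K : L ≤ K
    L≤K = subst (_≤ K) (InBlock⇒blockOf (≤-refl , tower-mono-< {suc L} ≤-refl)) (blockOf-mono start≤x)

InZ-of-SparseBlocks : ∀ A → (∀ Q → ∃ λ L → SparseBlocks A Q L) → InZ A
InZ-of-SparseBlocks A sparse k with sparse (4 * suc k)
... | L , sparse-L = tower (suc L) ⊔ 2 * (s * C) , λ x N≤x → *-cancelˡ-≤ 4 (begin
  4 * (s * count A x)           ≡⟨ *-comm-4 s (count A x) ⟩
  count A x * (4 * s)           ≤⟨ BlockwiseCount.count-≤-blocks sparse-L x (m⊔n≤o⇒m≤o (tower (suc L)) (2 * (s * C)) N≤x) ⟩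
  C * (4 * s) + 2 * x           ≡⟨ cong (_+ 2 * x) (*-comm-2-2 C s) ⟩
  2 * (2 * (s * C)) + 2 * x     ≤⟨ +-monoˡ-≤ (2 * x) (*-monoʳ-≤ 2 (m⊔n≤o⇒n≤o (tower (suc L)) (2 * (s * C)) N≤x)) ⟩
  2 * x + 2 * x                 ≡⟨ double-sum x ⟩
  4 * x                         ∎)
  where
  open ≤-Reasoning
  s = suc k
  C = count A (tower (suc L))
  *-comm-4 : ∀ s c → 4 * (s * c) ≡ c * (4 * s)
  *-comm-4 = solve-∀
  *-comm-2-2 : ∀ c s → c * (4 * s) ≡ 2 * (2 * (s * c))
  *-comm-2-2 = solve-∀
  double-sum : ∀ x → 2 * x + 2 * x ≡ 4 * x
  double-sum = solve-∀

-- The colouring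

module Colouring (f : ℕ → ℕ) where

  colour : List Bool → Bool
  colour s = bit (fromBits (take (blockOf (f (length s))) s)) (f (length s))

  -- the values f n that colour cannot read at level n, as their block exceeds n
  imageBelowBlock : SubsetΩ
  imageBelowBlock m = anyBelow (blockOf m) (λ n → f n ≡ᵇ m)

  imageBelowBlock-InZ : InZ imageBelowBlock
  imageBelowBlock-InZ = InZ-of-count≤blockOf imageBelowBlock λ x →
    count≤image f (blockOf x) imageBelowBlock x (preimage-below x)
    where
    preimage-below : ∀ x m → m < x → m ∈ˢ imageBelowBlock → ∃ λ n → n < blockOf x × f n ≡ m
    preimage-below x m m<x m∈image with anyBelow-elim (blockOf m) (λ n → f n ≡ᵇ m) m∈image
    ... | n , n<blockOf-m , fn≡ᵇm =
      n , <-≤-trans n<blockOf-m (blockOf-mono (<⇒≤ m<x)) , ≡ᵇ⇒≡ (f n) m (Equivalence.from T-≡ fn≡ᵇm)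

  module OnPerfectTree {p : Tree₀} (perfect : IsPerfect p) where
    open IsPerfect perfect
    open IsTree tree
    open TreeExtensions tree
    open LevelSizes perfect

    CodesConstant : Bool → SubsetΩ
    CodesConstant b m = Agrees (2 ^ blockOf m) (nodesAt (blockOf m)) b m

    CodesConstant-in-block : ∀ b k i → InBlock k (tower (suc k) + i) →
                             CodesConstant b (tower (suc k) + i) ≡ Agrees (2 ^ k) (nodesAt k) b i
    CodesConstant-in-block b k i inBlock = begin
      CodesConstant b (tower (suc k) + i)
        ≡⟨ cong (λ K → Agrees (2 ^ K) (nodesAt K) b (tower (suc k) + i)) (InBlock⇒blockOf {k} inBlock) ⟩
      Agrees (2 ^ k) (nodesAt k) b (tower (suc k) + i)
        ≡⟨ cong (λ t → Agrees (2 ^ k) (nodesAt k) b (t + i)) (tower-suc k) ⟩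
      Agrees (2 ^ k) (nodesAt k) b (tower k * tower k + i)
        ≡⟨ Agrees-periodic (2 ^ k) (nodesAt k) b (tower k) i ⟩
      Agrees (2 ^ k) (nodesAt k) b i ∎
      where open ≡-Reasoning

    CodesConstant-sparse : ∀ b Q → ∃ λ L → SparseBlocks (CodesConstant b) Q L
    CodesConstant-sparse b Q with level-size-unbounded Q
    ... | L , large-levels = L , λ k L≤k d in-block → begin
      count (λ i → CodesConstant b (tower (suc k) + i)) d * Q
        ≡⟨ cong (_* Q) (count-cong d (λ i i<d → CodesConstant-in-block b k i
             (m≤m+n (tower (suc k)) i , <-≤-trans (+-monoʳ-< (tower (suc k)) i<d) in-block))) ⟩
      count (Agrees (2 ^ k) (nodesAt k) b) d * Q
        ≤⟨ *-monoʳ-≤ (count (Agrees (2 ^ k) (nodesAt k) b) d) (<⇒≤ (<-trans (large-levels k L≤k) (n<2^n _))) ⟩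
      count (Agrees (2 ^ k) (nodesAt k) b) d * 2 ^ count (nodesAt k) (2 ^ k)
        ≤⟨ Agrees-density (2 ^ k) (nodesAt k) b d ⟩
      d + tower k ∎
      where open ≤-Reasoning

    Y : SubsetΩ
    Y m = imageBelowBlock m ∨ (CodesConstant true m ∨ CodesConstant false m)

    Y-InZ : InZ Y
    Y-InZ = InZ-∪ imageBelowBlock-InZ (InZ-∪ (InZ-of-SparseBlocks (CodesConstant true) (CodesConstant-sparse true))
                                             (InZ-of-SparseBlocks (CodesConstant false) (CodesConstant-sparse false)))

    colour-extendTo : ∀ n t → length t ≡ blockOf (f n) → blockOf (f n) ≤ n → colour (extendTo n t) ≡ bit (fromBits t) (f n)
    colour-extendTo n t |t|≡k k≤n = begin
      colour s                                              ≡⟨ cong (λ m → bit (fromBits (take (blockOf (f m)) s)) (f m)) |s|≡n ⟩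
      bit (fromBits (take (blockOf (f n)) s)) (f n)         ≡⟨ cong (λ k → bit (fromBits (take k s)) (f n)) |t|≡k ⟨
      bit (fromBits (take (length t) s)) (f n)              ≡⟨ cong (λ u → bit (fromBits u) (f n)) (take-⊑ (⊑-extendTo n t)) ⟩
      bit (fromBits t) (f n)                                ∎
      where
      open ≡-Reasoning
      s = extendTo n t
      |s|≡n = length-extendTo n t (subst (_≤ n) (sym |t|≡k) k≤n)

    image-CodesConstant : ∀ A → ConstantOnRestriction colour p A → ∀ n → n ∈ˢ A → blockOf (f n) ≤ n →
                          CodesConstant (colour (extendTo n [])) (f n) ≡ true
    image-CodesConstant A constant n n∈A k≤n = Agrees-intro (2 ^ k) (nodesAt k) _ (f n) λ i i<2^k t∈p →
      let t = toBits k i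
          |t|≡k = length-toBits k i
          |s|≡n = length-extendTo n t (subst (_≤ n) (sym |t|≡k) k≤n)
      in begin
      bit i (f n)                 ≡⟨ cong (λ j → bit j (f n)) (fromBits-toBits k i i<2^k) ⟨
      bit (fromBits t) (f n)      ≡⟨ colour-extendTo n t |t|≡k k≤n ⟨
      colour (extendTo n t)       ≡⟨ constant (extendTo n t) (extendTo n []) (extendTo-∈ n t t∈p) (extendTo-∈ n [] root)
                                      (subst (_∈ˢ A) (sym |s|≡n) n∈A) (subst (_∈ˢ A) (sym (length-extendTo n [] z≤n)) n∈A) ⟩
      colour (extendTo n [])      ∎
      where
      open ≡-Reasoning
      k = blockOf (f n)

    CodesConstant⊆Y : ∀ b m → CodesConstant b m ≡ true → Y m ≡ true
    CodesConstant⊆Y true  m m∈C =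
      trans (cong (λ c → imageBelowBlock m ∨ (c ∨ CodesConstant false m)) m∈C) (∨-zeroʳ (imageBelowBlock m))
    CodesConstant⊆Y false m m∈C =
      trans (cong (λ c → imageBelowBlock m ∨ (CodesConstant true m ∨ c)) m∈C)
            (trans (cong (imageBelowBlock m ∨_) (∨-zeroʳ _)) (∨-zeroʳ (imageBelowBlock m)))

    image-⊆-Y : ∀ A → ConstantOnRestriction colour p A → ∀ n → n ∈ˢ A → f n ∈ˢ Y
    image-⊆-Y A constant n n∈A with blockOf (f n) ≤? n
    ... | yes k≤n = CodesConstant⊆Y _ (f n) (image-CodesConstant A constant n n∈A k≤n)
    ... | no  k≰n = cong (_∨ (CodesConstant true (f n) ∨ CodesConstant false (f n)))
                         (anyBelow-intro (blockOf (f n)) (λ m → f m ≡ᵇ f n) n (≰⇒> k≰n)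
                                         (Equivalence.to T-≡ (≡⇒≡ᵇ (f n) (f n) refl)))

∩-∁-preimage-empty : ∀ {A Y} (f : ℕ → ℕ) → (∀ n → n ∈ˢ A → f n ∈ˢ Y) → (A ∩ˢ ∁ (preimage f Y)) ⊆ˢ ∅ˢ
∩-∁-preimage-empty {A} {Y} f A⊆f⁻¹Y n n∈A∖f⁻¹Y with A n in n∈A
... | false = n∈A∖f⁻¹Y
... | true  = trans (cong not (sym (A⊆f⁻¹Y n n∈A))) n∈A∖f⁻¹Y

corollary4p1 : (U : Family) → IsUltrafilter U → IsHalpernLauchli U → IsZUltrafilter U
corollary4p1 U ultrafilter halpern-läuchli (f , Z≤K-U*) with halpern-läuchli (Colouring.colour f)
... | p , A , perfect , A∈U , constant =
  proper (upward (A ∩ˢ ∁ (preimage f Y)) ∅ˢ (∩-∁-preimage-empty {A} {Y} f (image-⊆-Y A constant))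
                 (inter A (∁ (preimage f Y)) A∈U (Z≤K-U* Y Y-InZ)))
  where
  open IsUltrafilter ultrafilter
  open Colouring.OnPerfectTree f perfect
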